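{- Let $k\ge 2$ be an integer. Suppose that $\mathbf z=(z_1,\ldots,z_{2k+2})\in\mathbb Z^{2k+2}$ satisfies \[ \sum_{i=1}^{2k+2}z_i^{2j-1}=0\qquad (1\le j\le k), \] and that $z_i+z_j\ne 0$ for all $1\le i<j\le 2k+2$. Then \[ \prod_{i=3}^{2k+2}(z_1+z_i)=\prod_{i=3}^{2k+2}(z_2+z_i). \] -}

module Defs where

open import Data.Nat using (ℕ; zero; suc)
open import Data.Fin using (Fin; zero; suc)
open import Data.Integer using (ℤ; _+_; _*_; _^_; 0ℤ; 1ℤ)

sumFin : (n : ℕ) → (Fin n → ℤ) → ℤ
sumFin zero    f = 0ℤ
sumFin (suc n) f = f zero + sumFin n (λ i → f (suc i))

prodFin : (n : ℕ) → (Fin n → ℤ) → ℤ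
prodFin zero    f = 1ℤ
prodFin (suc n) f = f zero * prodFin n (λ i → f (suc i))

module Submission where

-- With e_m the elementary symmetric functions of z, P(x) = ∏ (x + z_i) = Σ_m e_m x^(2k+2−m).
-- Newton's identities turn the vanishing of the odd power sums p_1, p_3, …, p_(2k−1) into the
-- vanishing of e_1, e_3, …, e_(2k−1), so the odd part of P is a single term:
-- P(x) − P(−x) = 2x e_(2k+1).  At x = z_1 the factor −z_1 + z_1 kills P(−x), leaving
-- (z_1 + z_2) ∏_(i≥3) (z_1 + z_i) = e_(2k+1) (directly when z_1 = 0).  The right-hand side is
-- symmetric in z_1 and z_2, and z_1 + z_2 ≠ 0 can be cancelled.

open import Defs
open import Data.Nat using (ℕ; zero; suc; _≤_; _<_; s≤s; z<s) renaming (_+_ to _+ℕ_; _*_ to _*ℕ_)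
open import Data.Nat.Properties
  using (+-suc; ≤-refl; <⇒≤; n<1+n; m<n⇒m<1+n; m<1+n⇒m<n∨m≡n; m≤m+n; ≤-<-trans)
  renaming (+-identityʳ to +-identityʳℕ)
open import Data.Fin using (Fin; zero; suc; toℕ; fromℕ<)
open import Data.Fin.Properties using (toℕ-fromℕ<)
open import Data.Fin.Permutation.Components using (transpose)
open import Data.Integer using (ℤ; _+_; _*_; _-_; -_; _^_; +_; 0ℤ; 1ℤ; _≟_; ≢-nonZero)
open import Data.Integer.Properties
  using ( +-identityˡ; +-identityʳ; +-inverseˡ; +-comm; *-identityˡ; *-identityʳ; *-zeroˡ; *-zeroʳ
        ; *-cancelˡ-≡; i*j≡0⇒i≡0∨j≡0; ^-*-assoc)
open import Data.Integer.Tactic.RingSolver using (solve-∀)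
open import Data.Sum using (inj₁; inj₂)
open import Function using (_∘_)
open import Relation.Nullary using (yes; no)
open import Relation.Binary.PropositionalEquality
  using (_≡_; _≢_; refl; sym; trans; cong; cong₂; subst; module ≡-Reasoning)
open ≡-Reasoning

sumFin-cong : ∀ n {f g : Fin n → ℤ} → (∀ i → f i ≡ g i) → sumFin n f ≡ sumFin n g
sumFin-cong zero    f≗g = refl
sumFin-cong (suc n) f≗g = cong₂ _+_ (f≗g zero) (sumFin-cong n (f≗g ∘ suc))

prodFin-cong : ∀ n {f g : Fin n → ℤ} → (∀ i → f i ≡ g i) → prodFin n f ≡ prodFin n g
prodFin-cong zero    f≗g = refl
prodFin-cong (suc n) f≗g = cong₂ _*_ (f≗g zero) (prodFin-cong n (f≗g ∘ suc))

sumFin-distrib-+ : ∀ n (f g : Fin n → ℤ) → sumFin n (λ i → f i + g i) ≡ sumFin n f + sumFin n g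
sumFin-distrib-+ zero    f g = refl
sumFin-distrib-+ (suc n) f g =
  trans (cong (_+_ (f zero + g zero)) (sumFin-distrib-+ n (f ∘ suc) (g ∘ suc)))
        (interchange (f zero) (g zero) (sumFin n (f ∘ suc)) (sumFin n (g ∘ suc)))
  where
  interchange : ∀ a b c d → (a + b) + (c + d) ≡ (a + c) + (b + d)
  interchange = solve-∀

sumFin-*ˡ : ∀ n c (f : Fin n → ℤ) → sumFin n (λ i → c * f i) ≡ c * sumFin n f
sumFin-*ˡ zero    c f = sym (*-zeroʳ c)
sumFin-*ˡ (suc n) c f =
  trans (cong (_+_ (c * f zero)) (sumFin-*ˡ n c (f ∘ suc))) (distribˡ c (f zero) (sumFin n (f ∘ suc)))
  where
  distribˡ : ∀ c a b → c * a + c * b ≡ c * (a + b)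
  distribˡ = solve-∀

i+i≢0 : ∀ {i} → i ≢ 0ℤ → i + i ≢ 0ℤ
i+i≢0 {i} i≢0 i+i≡0 = i≢0 (*-cancelˡ-≡ (+ 2) i 0ℤ (trans (double i) i+i≡0))
  where
  double : ∀ i → + 2 * i ≡ i + i
  double = solve-∀

elemSym : (n : ℕ) → (Fin n → ℤ) → ℕ → ℤ
elemSym n       v zero    = 1ℤ
elemSym zero    v (suc m) = 0ℤ
elemSym (suc n) v (suc m) = elemSym n (v ∘ suc) (suc m) + v zero * elemSym n (v ∘ suc) m

elemSym-vanishes-above : ∀ n (v : Fin n → ℤ) {m} → n < m → elemSym n v m ≡ 0ℤ
elemSym-vanishes-above zero    v {suc m} _          = refl
elemSym-vanishes-above (suc n) v {suc m} (s≤s n<m) =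
  cong₂ _+_ (elemSym-vanishes-above n (v ∘ suc) (m<n⇒m<1+n n<m))
            (trans (cong (v zero *_) (elemSym-vanishes-above n (v ∘ suc) n<m)) (*-zeroʳ (v zero)))

elemSym-top : ∀ n (v : Fin n → ℤ) → elemSym n v n ≡ prodFin n v
elemSym-top zero    v = refl
elemSym-top (suc n) v =
  trans (cong₂ _+_ (elemSym-vanishes-above n (v ∘ suc) ≤-refl) (cong (v zero *_) (elemSym-top n (v ∘ suc))))
        (+-identityˡ _)

elemSym-zeroHead : ∀ n (v : Fin (suc n) → ℤ) m → v zero ≡ 0ℤ → elemSym (suc n) v m ≡ elemSym n (v ∘ suc) m
elemSym-zeroHead n v zero    v₀≡0 = refl
elemSym-zeroHead n v (suc m) v₀≡0 =
  trans (cong (λ a → elemSym n (v ∘ suc) (suc m) + a * elemSym n (v ∘ suc) m) v₀≡0) (+-identityʳ _)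

elemSym-swap₀₁ : ∀ n (v : Fin (suc (suc n)) → ℤ) m →
  elemSym (suc (suc n)) (v ∘ transpose zero (suc zero)) m ≡ elemSym (suc (suc n)) v m
elemSym-swap₀₁ n v zero          = refl
elemSym-swap₀₁ n v (suc zero)    = symmetric₁ (elemSym n (λ i → v (suc (suc i))) 1) (v zero) (v (suc zero))
  where
  symmetric₁ : ∀ e a b → (e + a * 1ℤ) + b * 1ℤ ≡ (e + b * 1ℤ) + a * 1ℤ
  symmetric₁ = solve-∀
elemSym-swap₀₁ n v (suc (suc m)) =
  symmetric (elemSym n w (suc (suc m))) (elemSym n w (suc m)) (elemSym n w m) (v zero) (v (suc zero))
  where
  w : Fin n → ℤ
  w i = v (suc (suc i))
  symmetric : ∀ e₂ e₁ e₀ a b → (e₂ + a * e₁) + b * (e₁ + a * e₀) ≡ (e₂ + b * e₁) + a * (e₁ + b * e₀)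
  symmetric = solve-∀

-- When a = v i, elemSymWithout n v a (suc m) is e_m of v with the entry v i removed:
-- the recurrence is that of dividing ∏ (x + v_j) by x + a.
elemSymWithout : (n : ℕ) → (Fin n → ℤ) → ℤ → ℕ → ℤ
elemSymWithout n v a zero    = 0ℤ
elemSymWithout n v a (suc m) = elemSym n v m - a * elemSymWithout n v a m

elemSymWithout-cons : ∀ n (v : Fin (suc n) → ℤ) a m →
  elemSymWithout (suc n) v a (suc m) ≡ elemSymWithout n (v ∘ suc) a (suc m) + v zero * elemSymWithout n (v ∘ suc) a m
elemSymWithout-cons n v a zero    = step₀ a (v zero)
  where
  step₀ : ∀ a b → 1ℤ - a * 0ℤ ≡ (1ℤ - a * 0ℤ) + b * 0ℤ
  step₀ = solve-∀
elemSymWithout-cons n v a (suc m) =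
  trans (cong (λ d → elemSym (suc n) v (suc m) - a * d) (elemSymWithout-cons n v a m))
        (step (elemSym n (v ∘ suc) (suc m)) (elemSym n (v ∘ suc) m)
              (elemSymWithout n (v ∘ suc) a (suc m)) (elemSymWithout n (v ∘ suc) a m) a (v zero))
  where
  step : ∀ e₁ e₀ d₁ d₀ a b → (e₁ + b * e₀) - a * (d₁ + b * d₀) ≡ (e₁ - a * d₁) + b * (e₀ - a * d₀)
  step = solve-∀

elemSymWithout-head : ∀ n (v : Fin (suc n) → ℤ) m → elemSymWithout (suc n) v (v zero) (suc m) ≡ elemSym n (v ∘ suc) m
elemSymWithout-head n v zero    = step₀ (v zero)
  where
  step₀ : ∀ a → 1ℤ - a * 0ℤ ≡ 1ℤ
  step₀ = solve-∀
elemSymWithout-head n v (suc m) =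
  trans (cong (λ d → elemSym (suc n) v (suc m) - v zero * d) (elemSymWithout-head n v m))
        (step (elemSym n (v ∘ suc) (suc m)) (elemSym n (v ∘ suc) m) (v zero))
  where
  step : ∀ e₁ e₀ a → (e₁ + a * e₀) - a * e₀ ≡ e₁
  step = solve-∀

-- Euler's identity for the homogeneous e_m, as ∂e_m/∂v_i = e_(m−1)(v without v_i).
elemSym-euler : ∀ n (v : Fin n → ℤ) m → sumFin n (λ i → v i * elemSymWithout n v (v i) m) ≡ + m * elemSym n v m
elemSym-euler zero    v zero    = refl
elemSym-euler zero    v (suc m) = sym (*-zeroʳ (+ suc m))
elemSym-euler (suc n) v zero    = cong₂ _+_ (*-zeroʳ (v zero)) (elemSym-euler n (v ∘ suc) zero)
elemSym-euler (suc n) v (suc m) = begin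
    a * elemSymWithout (suc n) v a (suc m) + sumFin n (λ i → w i * elemSymWithout (suc n) v (w i) (suc m))
  ≡⟨ cong₂ _+_ (cong (a *_) (elemSymWithout-head n v m))
               (sumFin-cong n λ i → trans (cong (w i *_) (elemSymWithout-cons n v (w i) m)) (distrib (w i) _ a _)) ⟩
    a * elemSym n w m + sumFin n (λ i → w i * D (w i) (suc m) + a * (w i * D (w i) m))
  ≡⟨ cong (_+_ (a * elemSym n w m)) (sumFin-distrib-+ n _ _) ⟩
    a * elemSym n w m + (sumFin n (λ i → w i * D (w i) (suc m)) + sumFin n (λ i → a * (w i * D (w i) m)))
  ≡⟨ cong (_+_ (a * elemSym n w m))
          (cong₂ _+_ (elemSym-euler n w (suc m)) (trans (sumFin-*ˡ n a _) (cong (a *_) (elemSym-euler n w m)))) ⟩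
    a * elemSym n w m + (+ suc m * elemSym n w (suc m) + a * (+ m * elemSym n w m))
  ≡⟨ collect a (elemSym n w (suc m)) (elemSym n w m) (+ m) ⟩
    + suc m * (elemSym n w (suc m) + a * elemSym n w m)
  ∎
  where
  a : ℤ
  a = v zero
  w : Fin n → ℤ
  w = v ∘ suc
  D : ℤ → ℕ → ℤ
  D = elemSymWithout n w
  distrib : ∀ x d₁ b d₀ → x * (d₁ + b * d₀) ≡ x * d₁ + b * (x * d₀)
  distrib = solve-∀
  collect : ∀ a e₁ e₀ m → a * e₀ + ((1ℤ + m) * e₁ + a * (m * e₀)) ≡ (1ℤ + m) * (e₁ + a * e₀)
  collect = solve-∀

^-odd : ∀ a s → a ^ suc (2 *ℕ s) ≡ a * (a * a) ^ s
^-odd a s = cong (a *_) (trans (sym (^-*-assoc a 2 s)) (cong (λ b → (a * b) ^ s) (*-identityʳ a)))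

OddPowerSumsVanish : (n : ℕ) → (Fin n → ℤ) → ℕ → Set
OddPowerSumsVanish n v K = ∀ s → s < K → sumFin n (λ i → v i * (v i * v i) ^ s) ≡ 0ℤ

OddElemSymVanish : (n : ℕ) → (Fin n → ℤ) → ℕ → Set
OddElemSymVanish n v K = ∀ t → t < K → elemSym n v (suc (t +ℕ t)) ≡ 0ℤ

-- e_(2u)(v without a) = e_(2u) + a² e_(2u−2)(v without a) once e_(2u−1) = 0, so this sum unfolds
-- into the odd power sums p_(2s+1), …, p_(2s+2u+1).
oddPowerSum-elemSymWithout≡0 : ∀ {n} (v : Fin n → ℤ) {K} → OddPowerSumsVanish n v K →
  ∀ u → OddElemSymVanish n v u → ∀ s → s +ℕ u < K →
  sumFin n (λ i → (v i * v i) ^ s * (v i * elemSymWithout n v (v i) (suc (u +ℕ u)))) ≡ 0ℤ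
oddPowerSum-elemSymWithout≡0 {n} v {K} p zero _ s s<K =
  trans (sumFin-cong n λ i → base ((v i * v i) ^ s) (v i)) (p s (subst (_< K) (+-identityʳℕ s) s<K))
  where
  base : ∀ w a → w * (a * (1ℤ - a * 0ℤ)) ≡ a * w
  base = solve-∀
oddPowerSum-elemSymWithout≡0 {n} v {K} p (suc u) odd s s+u<K rewrite +-suc u u = begin
    sumFin n (λ i → (v i * v i) ^ s * (v i * (e₂ - v i * (e₁ - v i * D (v i)))))
  ≡⟨ sumFin-cong n (λ i → unfold ((v i * v i) ^ s) (v i) e₂ e₁ (D (v i)) (odd u (n<1+n u))) ⟩
    sumFin n (λ i → e₂ * (v i * (v i * v i) ^ s) + (v i * v i) ^ suc s * (v i * D (v i)))
  ≡⟨ sumFin-distrib-+ n _ _ ⟩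
    sumFin n (λ i → e₂ * (v i * (v i * v i) ^ s)) + sumFin n (λ i → (v i * v i) ^ suc s * (v i * D (v i)))
  ≡⟨ cong₂ _+_ (trans (sumFin-*ˡ n e₂ _) (cong (e₂ *_) (p s (≤-<-trans (m≤m+n s (suc u)) s+u<K))))
               (oddPowerSum-elemSymWithout≡0 v p u (λ t t<u → odd t (m<n⇒m<1+n t<u)) (suc s) (subst (_< K) (+-suc s u) s+u<K)) ⟩
    e₂ * 0ℤ + 0ℤ
  ≡⟨ cong (_+ 0ℤ) (*-zeroʳ e₂) ⟩
    0ℤ
  ∎
  where
  e₂ e₁ : ℤ
  e₂ = elemSym n v (suc (suc (u +ℕ u)))
  e₁ = elemSym n v (suc (u +ℕ u))
  D : ℤ → ℤ
  D a = elemSymWithout n v a (suc (u +ℕ u))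
  unfold : ∀ w a x y d → y ≡ 0ℤ → w * (a * (x - a * (y - a * d))) ≡ x * (a * w) + ((a * a) * w) * (a * d)
  unfold w a x y d refl = unfold₀ w a x d
    where
    unfold₀ : ∀ w a x d → w * (a * (x - a * (0ℤ - a * d))) ≡ x * (a * w) + ((a * a) * w) * (a * d)
    unfold₀ = solve-∀

oddElemSym-next : ∀ {n} (v : Fin n → ℤ) {K t} → OddPowerSumsVanish n v K → t < K → OddElemSymVanish n v t →
  elemSym n v (suc (t +ℕ t)) ≡ 0ℤ
oddElemSym-next {n} v {t = t} p t<K odd
  with i*j≡0⇒i≡0∨j≡0 (+ suc (t +ℕ t)) (begin
    + suc (t +ℕ t) * elemSym n v (suc (t +ℕ t))
  ≡⟨ sym (elemSym-euler n v (suc (t +ℕ t))) ⟩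
    sumFin n (λ i → v i * elemSymWithout n v (v i) (suc (t +ℕ t)))
  ≡⟨ sumFin-cong n (λ i → sym (*-identityˡ _)) ⟩
    sumFin n (λ i → (v i * v i) ^ 0 * (v i * elemSymWithout n v (v i) (suc (t +ℕ t))))
  ≡⟨ oddPowerSum-elemSymWithout≡0 v p t odd 0 t<K ⟩
    0ℤ
  ∎)
... | inj₂ e≡0 = e≡0

oddElemSym-vanish : ∀ {n} (v : Fin n → ℤ) {K} → OddPowerSumsVanish n v K → ∀ t → t ≤ K → OddElemSymVanish n v t
oddElemSym-vanish v p (suc t) t<K t′ t′<1+t with m<1+n⇒m<n∨m≡n t′<1+t
... | inj₁ t′<t = oddElemSym-vanish v p t (<⇒≤ t<K) t′ t′<t
... | inj₂ refl = oddElemSym-next v p t<K (oddElemSym-vanish v p t (<⇒≤ t<K))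

elemSymPoly : (n : ℕ) → (Fin n → ℤ) → ℤ → ℕ → ℤ
elemSymPoly n v x zero    = 1ℤ
elemSymPoly n v x (suc m) = x * elemSymPoly n v x m + elemSym n v (suc m)

elemSymPoly-cons : ∀ n (v : Fin (suc n) → ℤ) x m →
  elemSymPoly (suc n) v x (suc m) ≡ elemSymPoly n (v ∘ suc) x (suc m) + v zero * elemSymPoly n (v ∘ suc) x m
elemSymPoly-cons n v x zero    = step₀ x (elemSym n (v ∘ suc) 1) (v zero)
  where
  step₀ : ∀ x e b → x * 1ℤ + (e + b * 1ℤ) ≡ (x * 1ℤ + e) + b * 1ℤ
  step₀ = solve-∀
elemSymPoly-cons n v x (suc m) =
  trans (cong (λ q → x * q + elemSym (suc n) v (suc (suc m))) (elemSymPoly-cons n v x m))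
        (step x (elemSymPoly n w x (suc m)) (v zero) (elemSymPoly n w x m) (elemSym n w (suc (suc m))) (elemSym n w (suc m)))
  where
  w : Fin n → ℤ
  w = v ∘ suc
  step : ∀ x q₁ b q₀ e₂ e₁ → x * (q₁ + b * q₀) + (e₂ + b * e₁) ≡ (x * q₁ + e₂) + b * (x * q₀ + e₁)
  step = solve-∀

elemSymPoly-full : ∀ n (v : Fin n → ℤ) x → elemSymPoly n v x n ≡ prodFin n (λ i → x + v i)
elemSymPoly-full zero    v x = refl
elemSymPoly-full (suc n) v x = begin
    elemSymPoly (suc n) v x (suc n)
  ≡⟨ elemSymPoly-cons n v x n ⟩
    (x * elemSymPoly n w x n + elemSym n w (suc n)) + v zero * elemSymPoly n w x n
  ≡⟨ cong₂ (λ q e → (x * q + e) + v zero * q) (elemSymPoly-full n w x) (elemSym-vanishes-above n w ≤-refl) ⟩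
    (x * Q + 0ℤ) + v zero * Q
  ≡⟨ collect x (v zero) Q ⟩
    (x + v zero) * Q
  ∎
  where
  w : Fin n → ℤ
  w = v ∘ suc
  Q : ℤ
  Q = prodFin n (λ i → x + w i)
  collect : ∀ x b q → (x * q + 0ℤ) + b * q ≡ (x + b) * q
  collect = solve-∀

elemSymPoly-even : ∀ {n} (v : Fin n → ℤ) u → OddElemSymVanish n v u → ∀ x →
  elemSymPoly n v x (u +ℕ u) ≡ elemSymPoly n v (- x) (u +ℕ u)
elemSymPoly-even v zero    odd x = refl
elemSymPoly-even v (suc u) odd x
  rewrite +-suc u u | odd u (n<1+n u) | elemSymPoly-even v u (λ t t<u → odd t (m<n⇒m<1+n t<u)) x
  = even _ x _
  where
  even : ∀ q x e → x * (x * q + 0ℤ) + e ≡ - x * (- x * q + 0ℤ) + e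
  even = solve-∀

prodFin-oddPart : ∀ K (v : Fin (suc (suc (K +ℕ K))) → ℤ) → OddElemSymVanish _ v K → ∀ x →
  prodFin _ (λ i → x + v i) ≡ prodFin _ (λ i → - x + v i) + (x + x) * elemSym _ v (suc (K +ℕ K))
prodFin-oddPart K v odd x = begin
    prodFin _ (λ i → x + v i)
  ≡⟨ sym (elemSymPoly-full _ v x) ⟩
    x * (x * P x + e₁) + e₂
  ≡⟨ cong (λ q → x * (x * q + e₁) + e₂) (elemSymPoly-even v K odd x) ⟩
    x * (x * P (- x) + e₁) + e₂
  ≡⟨ oddPart x (P (- x)) e₁ e₂ ⟩
    (- x * (- x * P (- x) + e₁) + e₂) + (x + x) * e₁
  ≡⟨ cong (_+ (x + x) * e₁) (elemSymPoly-full _ v (- x)) ⟩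
    prodFin _ (λ i → - x + v i) + (x + x) * e₁
  ∎
  where
  P : ℤ → ℤ
  P y = elemSymPoly _ v y (K +ℕ K)
  e₁ e₂ : ℤ
  e₁ = elemSym _ v (suc (K +ℕ K))
  e₂ = elemSym _ v (suc (suc (K +ℕ K)))
  oddPart : ∀ x q e₁ e₂ → x * (x * q + e₁) + e₂ ≡ (- x * (- x * q + e₁) + e₂) + (x + x) * e₁
  oddPart = solve-∀

head-prodFin≡elemSym-zeroHead : ∀ N (v : Fin (suc (suc N)) → ℤ) → v zero ≡ 0ℤ →
  (v zero + v (suc zero)) * prodFin N (λ i → v zero + v (suc (suc i))) ≡ elemSym _ v (suc N)
head-prodFin≡elemSym-zeroHead N v v₀≡0 = begin
    (v zero + v (suc zero)) * prodFin N (λ i → v zero + w i)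
  ≡⟨ cong (λ a → (a + v (suc zero)) * prodFin N (λ i → a + w i)) v₀≡0 ⟩
    (0ℤ + v (suc zero)) * prodFin N (λ i → 0ℤ + w i)
  ≡⟨ cong₂ _*_ (+-identityˡ (v (suc zero))) (prodFin-cong N (λ i → +-identityˡ (w i))) ⟩
    prodFin (suc N) (v ∘ suc)
  ≡⟨ sym (elemSym-top (suc N) (v ∘ suc)) ⟩
    elemSym (suc N) (v ∘ suc) (suc N)
  ≡⟨ sym (elemSym-zeroHead (suc N) v (suc N) v₀≡0) ⟩
    elemSym _ v (suc N)
  ∎
  where
  w : Fin N → ℤ
  w i = v (suc (suc i))

head-prodFin≡elemSym : ∀ K (v : Fin (suc (suc (K +ℕ K))) → ℤ) → OddElemSymVanish _ v K →
  (v zero + v (suc zero)) * prodFin (K +ℕ K) (λ i → v zero + v (suc (suc i))) ≡ elemSym _ v (suc (K +ℕ K))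
head-prodFin≡elemSym K v odd with v zero ≟ 0ℤ
... | yes v₀≡0 = head-prodFin≡elemSym-zeroHead (K +ℕ K) v v₀≡0
... | no  v₀≢0 = *-cancelˡ-≡ (a + a) _ _ {{≢-nonZero (i+i≢0 v₀≢0)}} (begin
    prodFin _ (λ i → a + v i)
  ≡⟨ prodFin-oddPart K v odd a ⟩
    (- a + a) * R + (a + a) * c
  ≡⟨ cong (λ b → b * R + (a + a) * c) (+-inverseˡ a) ⟩
    0ℤ * R + (a + a) * c
  ≡⟨ cong (_+ (a + a) * c) (*-zeroˡ R) ⟩
    0ℤ + (a + a) * c
  ≡⟨ +-identityˡ _ ⟩
    (a + a) * c
  ∎)
  where
  a R c : ℤ
  a = v zero
  R = prodFin _ (λ i → - a + v (suc i))
  c = elemSym _ v (suc (K +ℕ K))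

lemma2p1 : (k : ℕ) → 2 ≤ k → (z : Fin (suc (suc (k +ℕ k))) → ℤ)
  → ((j : Fin k) → sumFin (suc (suc (k +ℕ k))) (λ i → z i ^ (suc (2 *ℕ toℕ j))) ≡ 0ℤ)
  → ((i j : Fin (suc (suc (k +ℕ k)))) → toℕ i < toℕ j → z i + z j ≢ 0ℤ)
  → prodFin (k +ℕ k) (λ i → z zero + z (suc (suc i)))
    ≡ prodFin (k +ℕ k) (λ i → z (suc zero) + z (suc (suc i)))
lemma2p1 k _ z powerSums distinct =
  *-cancelˡ-≡ (z zero + z (suc zero)) _ _ {{≢-nonZero (distinct zero (suc zero) z<s)}} (begin
    (z zero + z (suc zero)) * prodFin (k +ℕ k) (λ i → z zero + z (suc (suc i)))
  ≡⟨ head-prodFin≡elemSym k z oddZ ⟩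
    elemSym _ z (suc (k +ℕ k))
  ≡⟨ sym (elemSym-swap₀₁ _ z (suc (k +ℕ k))) ⟩
    elemSym _ z′ (suc (k +ℕ k))
  ≡⟨ sym (head-prodFin≡elemSym k z′ (λ t t<k → trans (elemSym-swap₀₁ _ z _) (oddZ t t<k))) ⟩
    (z (suc zero) + z zero) * prodFin (k +ℕ k) (λ i → z (suc zero) + z (suc (suc i)))
  ≡⟨ cong (_* prodFin (k +ℕ k) (λ i → z (suc zero) + z (suc (suc i)))) (+-comm (z (suc zero)) (z zero)) ⟩
    (z zero + z (suc zero)) * prodFin (k +ℕ k) (λ i → z (suc zero) + z (suc (suc i)))
  ∎)
  where
  z′ : Fin (suc (suc (k +ℕ k))) → ℤ
  z′ = z ∘ transpose zero (suc zero)
  oddZ : OddElemSymVanish _ z k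
  oddZ = oddElemSym-vanish z (λ s s<k → trans (sumFin-cong _ (λ i → sym (^-odd (z i) s)))
    (subst (λ j → sumFin _ (λ i → z i ^ suc (2 *ℕ j)) ≡ 0ℤ) (toℕ-fromℕ< s<k) (powerSums (fromℕ< s<k)))) k ≤-refl
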